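{- Let $A$ be an $m\times n$ matrix with entries in $\{0,1\}$. Regard each row and each column of $A$ as a binary string read from its first entry (row index $0$ / column index $0$) onward, and fix one lexicographic order on such strings, used for both rows and columns (for instance the reverse order in which $1$ precedes $0$). Consider the process that alternately (i) permutes the rows of the current matrix so that they appear in sorted order and (ii) permutes the columns of the current matrix so that they appear in sorted order. Then after finitely many steps the process reaches a fixed point, i.e. a matrix whose rows and columns are simultaneously sorted. The same conclusion holds if the set of row positions and the set of column positions are each partitioned into parts and each sorting step only rearranges rows (respectively columns) among the positions of the same part, sorting them within that part, so that no row or column moves across parts.
   Context: Sorting rows means reordering the rows so that they are in (weakly) monotone order with respect to the fixed lexicographic order; similarly for columns. -}

module Defs where

open import Data.Bool using (Bool; true; false)
open import Data.Nat using (ℕ; zero; suc; _+_; _*_)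
open import Data.Fin using (Fin; _<_; _≤_)
open import Data.Fin.Permutation using (Permutation′; _⟨$⟩ʳ_)
open import Data.Product using (Σ; ∃; _×_; _,_)
open import Data.Sum using (_⊎_)
open import Relation.Binary.PropositionalEquality using (_≡_)

-- An m × n matrix with entries in {0,1} (false = 0, true = 1).
Mat : ℕ → ℕ → Set
Mat m n = Fin m → Fin n → Bool

BitString : ℕ → Set
BitString n = Fin n → Bool

-- The choice of the order on the alphabet {0,1}:
--   o = false : 0 precedes 1 ;  o = true : 1 precedes 0.
-- BitLt o x y : x strictly precedes y in the chosen alphabet order.
BitLt : Bool → Bool → Bool → Set
BitLt false x y = (x ≡ false) × (y ≡ true)
BitLt true  x y = (x ≡ true)  × (y ≡ false)

LexLeq : Bool → {n : ℕ} → BitString n → BitString n → Set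
LexLeq o {n} u v =
  (∀ k → u k ≡ v k)
  ⊎ (Σ (Fin n) λ k → (∀ j → j < k → u j ≡ v j) × BitLt o (u k) (v k))

row : {m n : ℕ} → Mat m n → Fin m → BitString n
row A i = λ j → A i j

col : {m n : ℕ} → Mat m n → Fin n → BitString m
col A j = λ i → A i j

-- Rows sorted within parts: p labels each row position by its part.
RowsSorted : Bool → {m n : ℕ} → (Fin m → ℕ) → Mat m n → Set
RowsSorted o {m} p A =
  ∀ (i i′ : Fin m) → p i ≡ p i′ → i ≤ i′ → LexLeq o (row A i) (row A i′)

ColsSorted : Bool → {m n : ℕ} → (Fin n → ℕ) → Mat m n → Set
ColsSorted o {m} {n} q A =
  ∀ (j j′ : Fin n) → q j ≡ q j′ → j ≤ j′ → LexLeq o (col A j) (col A j′)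

RowSortStep : Bool → {m n : ℕ} → (Fin m → ℕ) → Mat m n → Mat m n → Set
RowSortStep o {m} p A B =
  Σ (Permutation′ m) λ σ →
    (∀ i → p (σ ⟨$⟩ʳ i) ≡ p i)
    × (∀ i j → B i j ≡ A (σ ⟨$⟩ʳ i) j)
    × RowsSorted o p B

ColSortStep : Bool → {m n : ℕ} → (Fin n → ℕ) → Mat m n → Mat m n → Set
ColSortStep o {m} {n} q A B =
  Σ (Permutation′ n) λ τ →
    (∀ j → q (τ ⟨$⟩ʳ j) ≡ q j)
    × (∀ i j → B i j ≡ A i (τ ⟨$⟩ʳ j))
    × ColsSorted o q B

IsRun : Bool → {m n : ℕ} → (Fin m → ℕ) → (Fin n → ℕ) → Mat m n → (ℕ → Mat m n) → Set
IsRun o p q A f =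
  (f 0 ≡ A)
  × (∀ t → RowSortStep o p (f (2 * t)) (f (suc (2 * t))))
  × (∀ t → ColSortStep o q (f (suc (2 * t))) (f (suc (suc (2 * t)))))

-- Read the matrix row by row as one word over the alphabet {0,1} ordered by o.
-- Every sorting step, of rows or of columns, either changes nothing or makes
-- this word strictly smaller in the lexicographic order: at the first place
-- where the matrix changes, the permutation must have brought in, at that
-- position or after it in the same part, a copy of what was there before, and
-- sortedness of the result then forces the new entry to be the smaller one.
-- Coding the word as a natural number, the process can only change the matrix
-- finitely often, and a step that changes nothing leaves it sorted both ways.
module Submission where

open import Defs
open import Data.Bool using (Bool; true; false)
open import Data.Bool.Properties using () renaming (_≟_ to _≟ᵇ_)
import Data.Nat as ℕ
open import Data.Nat using (ℕ; zero; suc; _+_; _*_; _^_; z≤n; s≤s; s≤s⁻¹)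
open import Data.Nat.Properties
  using (+-comm; +-monoʳ-<; *-monoˡ-≤; *-suc; m≤m+n; <-trans; <-≤-trans; ≰⇒>; n<1+n; module ≤-Reasoning)
open import Data.Fin using (Fin; zero; suc; toℕ; _<_; _≤_)
open import Data.Fin.Properties using (all?; _≤?_; <-cmp; <-irrefl; pigeonhole)
open import Data.Fin.Permutation using (Permutation′; _⟨$⟩ʳ_; _⟨$⟩ˡ_; inverseʳ)
open import Data.Product using (Σ; ∃; _×_; _,_; proj₂)
open import Data.Sum using (_⊎_; inj₁; inj₂)
open import Data.Empty using (⊥-elim)
open import Function using (_∘_)
open import Relation.Nullary using (Dec; yes; no; ¬_)
open import Relation.Binary.Definitions using (tri<; tri≈; tri>)
open import Relation.Binary.PropositionalEquality
  using (_≡_; _≢_; refl; sym; trans; cong; cong₂; subst)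

rank : Bool → Bool → ℕ
rank false false = 0
rank false true  = 1
rank true  true  = 0
rank true  false = 1

rank<2 : ∀ o b → rank o b ℕ.< 2
rank<2 false false = s≤s z≤n
rank<2 false true  = s≤s (s≤s z≤n)
rank<2 true  true  = s≤s z≤n
rank<2 true  false = s≤s (s≤s z≤n)

BitLt⇒rank< : ∀ o {x y} → BitLt o x y → rank o x ℕ.< rank o y
BitLt⇒rank< false (refl , refl) = s≤s z≤n
BitLt⇒rank< true  (refl , refl) = s≤s z≤n

≡⇒¬BitLt : ∀ o {x y} → x ≡ y → ¬ BitLt o x y
≡⇒¬BitLt false refl (refl , ())
≡⇒¬BitLt true  refl (refl , ())

Lex< : {A : Set} → (A → A → Set) → {n : ℕ} → (Fin n → A) → (Fin n → A) → Set
Lex< _≺_ {n} u v = Σ (Fin n) λ k → (∀ j → j < k → u j ≡ v j) × u k ≺ v k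

Lex<-map : ∀ {A B : Set} {_≺_ : A → A → Set} {_⊏_ : B → B → Set} (f : A → B) →
           (∀ {x y} → x ≺ y → f x ⊏ f y) →
           ∀ {n} {u v : Fin n → A} → Lex< _≺_ u v → Lex< _⊏_ (f ∘ u) (f ∘ v)
Lex<-map f mono (k , agree , u≺v) = k , (λ j j<k → cong f (agree j j<k)) , mono u≺v

least-counterexample : ∀ {n} (P : Fin n → Set) → (∀ i → Dec (P i)) →
                       (∀ i → P i) ⊎ ∃ λ i → (∀ j → j < i → P j) × ¬ P i
least-counterexample {zero}  P P? = inj₁ λ ()
least-counterexample {suc n} P P? with P? zero
... | no ¬P₀ = inj₂ (zero , (λ _ ()) , ¬P₀)
... | yes P₀ with least-counterexample (P ∘ suc) (P? ∘ suc)
...   | inj₁ all = inj₁ λ { zero → P₀ ; (suc i) → all i }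
...   | inj₂ (i , below , ¬Pi) =
        inj₂ (suc i , (λ { zero _ → P₀ ; (suc j) j<i → below j (s≤s⁻¹ j<i) }) , ¬Pi)

-- Following the σ⁻¹-orbit of i: while it stays below i, P propagates along
-- it; since the orbit returns to i, it must leave [0, i) at some point.
orbit-escapes : ∀ {N} (σ : Permutation′ N) (P : Fin N → Set) {i : Fin N} → P i →
                (∀ k → k < i → P (σ ⟨$⟩ʳ k) → P k) →
                ∃ λ k → i ≤ k × P (σ ⟨$⟩ʳ k)
orbit-escapes {N} σ P {i} Pi closed = escape returned
  where
  orbit : ℕ → Fin N
  orbit zero    = i
  orbit (suc c) = σ ⟨$⟩ˡ orbit c

  Escaped : Set
  Escaped = ∃ λ k → i ≤ k × P (σ ⟨$⟩ʳ k)

  advance : ∀ c → P (σ ⟨$⟩ʳ orbit (suc c)) → Escaped ⊎ (orbit (suc c) < i × P (orbit (suc c)))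
  advance c P-σk with i ≤? orbit (suc c)
  ... | yes i≤k = inj₁ (orbit (suc c) , i≤k , P-σk)
  ... | no  i≰k = inj₂ (≰⇒> i≰k , closed _ (≰⇒> i≰k) P-σk)

  pull : ∀ c → P (orbit c) → P (σ ⟨$⟩ʳ orbit (suc c))
  pull c = subst P (sym (inverseʳ σ))

  trapped : ∀ c → Escaped ⊎ (orbit (suc c) < i × P (orbit (suc c)))
  trapped zero    = advance zero (pull zero Pi)
  trapped (suc c) with trapped c
  ... | inj₁ escaped       = inj₁ escaped
  ... | inj₂ (_ , P-orbit) = advance (suc c) (pull (suc c) P-orbit)

  ⟨$⟩ˡ-injective : ∀ {x y} → σ ⟨$⟩ˡ x ≡ σ ⟨$⟩ˡ y → x ≡ y
  ⟨$⟩ˡ-injective eq = trans (sym (inverseʳ σ)) (trans (cong (σ ⟨$⟩ʳ_) eq) (inverseʳ σ))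

  returns : ∀ a b → a ℕ.< b → orbit a ≡ orbit b → ∃ λ d → orbit (suc d) ≡ i
  returns zero    (suc b) _       eq = b , sym eq
  returns (suc a) (suc b) (s≤s a<b) eq = returns a b a<b (⟨$⟩ˡ-injective eq)

  returned : ∃ λ d → orbit (suc d) ≡ i
  returned with a , b , a<b , same ← pigeonhole (n<1+n N) (orbit ∘ toℕ) =
    returns (toℕ a) (toℕ b) a<b same

  escape : (∃ λ d → orbit (suc d) ≡ i) → Escaped
  escape (d , back) with trapped d
  ... | inj₁ escaped     = escaped
  ... | inj₂ (below , _) = ⊥-elim (<-irrefl back below)

value : ℕ → {n : ℕ} → (Fin n → ℕ) → ℕ
value b {zero}  d = 0
value b {suc n} d = d zero * b ^ n + value b (d ∘ suc)

value-cong : ∀ b {n} {d e : Fin n → ℕ} → (∀ k → d k ≡ e k) → value b d ≡ value b e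
value-cong b {zero}  d≡e = refl
value-cong b {suc n} d≡e = cong₂ (λ x y → x * b ^ n + y) (d≡e zero) (value-cong b (d≡e ∘ suc))

value<b^n : ∀ b {n} (d : Fin n → ℕ) → (∀ k → d k ℕ.< b) → value b d ℕ.< b ^ n
value<1+leading : ∀ b {n} (d : Fin (suc n) → ℕ) → (∀ k → d k ℕ.< b) →
                  value b d ℕ.< suc (d zero) * b ^ n

value<b^n b {zero}  d d<b = s≤s z≤n
value<b^n b {suc n} d d<b = <-≤-trans (value<1+leading b d d<b) (*-monoˡ-≤ (b ^ n) (d<b zero))

value<1+leading b {n} d d<b = begin-strict
  d zero * b ^ n + value b (d ∘ suc) <⟨ +-monoʳ-< _ (value<b^n b (d ∘ suc) (d<b ∘ suc)) ⟩
  d zero * b ^ n + b ^ n              ≡⟨ +-comm (d zero * b ^ n) (b ^ n) ⟩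
  suc (d zero) * b ^ n                ∎
  where open ≤-Reasoning

value-mono : ∀ b {n} {d e : Fin n → ℕ} → (∀ k → d k ℕ.< b) → Lex< ℕ._<_ d e → value b d ℕ.< value b e
value-mono b {suc n} {d} {e} d<b (zero , _ , d₀<e₀) = begin-strict
  value b d                          <⟨ value<1+leading b d d<b ⟩
  suc (d zero) * b ^ n               ≤⟨ *-monoˡ-≤ (b ^ n) d₀<e₀ ⟩
  e zero * b ^ n                     ≤⟨ m≤m+n _ _ ⟩
  value b e                          ∎
  where open ≤-Reasoning
value-mono b {suc n} {d} {e} d<b (suc k , agree , dₖ<eₖ) = begin-strict
  d zero * b ^ n + value b (d ∘ suc) ≡⟨ cong (λ x → x * b ^ n + value b (d ∘ suc)) (agree zero (s≤s z≤n)) ⟩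
  e zero * b ^ n + value b (d ∘ suc) <⟨ +-monoʳ-< _ (value-mono b (d<b ∘ suc) tail<) ⟩
  e zero * b ^ n + value b (e ∘ suc) ∎
  where
  open ≤-Reasoning
  tail< : Lex< ℕ._<_ (d ∘ suc) (e ∘ suc)
  tail< = k , (λ j j<k → agree (suc j) (s≤s j<k)) , dₖ<eₖ

code : Bool → {n : ℕ} → BitString n → ℕ
code o u = value 2 (rank o ∘ u)

code<2^n : ∀ o {n} (u : BitString n) → code o u ℕ.< 2 ^ n
code<2^n o u = value<b^n 2 (rank o ∘ u) (rank<2 o ∘ u)

code-mono : ∀ o {n} {u v : BitString n} → Lex< (BitLt o) u v → code o u ℕ.< code o v
code-mono o {u = u} = value-mono 2 (rank<2 o ∘ u) ∘ Lex<-map {_⊏_ = ℕ._<_} (rank o) (BitLt⇒rank< o)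

weight : Bool → {m n : ℕ} → Mat m n → ℕ
weight o {n = n} A = value (2 ^ n) (code o ∘ row A)

weight-mono : ∀ o {m n} {A B : Mat m n} (r : Fin m) → (∀ i → i < r → ∀ j → B i j ≡ A i j) →
              code o (row B r) ℕ.< code o (row A r) → weight o B ℕ.< weight o A
weight-mono o {B = B} r agree B<A =
  value-mono _ (code<2^n o ∘ row B) (r , (λ i i<r → value-cong 2 (cong (rank o) ∘ agree i i<r)) , B<A)

LexLeq-resp : ∀ o {n} {u u′ v v′ : BitString n} → (∀ k → u k ≡ u′ k) → (∀ k → v k ≡ v′ k) →
              LexLeq o u v → LexLeq o u′ v′
LexLeq-resp o u≡u′ v≡v′ (inj₁ u≡v) = inj₁ λ k → trans (sym (u≡u′ k)) (trans (u≡v k) (v≡v′ k))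
LexLeq-resp o u≡u′ v≡v′ (inj₂ (k , agree , uₖ<vₖ)) =
  inj₂ (k , (λ j j<k → trans (sym (u≡u′ j)) (trans (agree j j<k) (v≡v′ j)))
          , subst (BitLt o _) (v≡v′ k) (subst (λ x → BitLt o x _) (u≡u′ k) uₖ<vₖ))

LexLeq⇒Lex< : ∀ o {n} {u v : BitString n} → LexLeq o u v → ¬ (∀ k → u k ≡ v k) → Lex< (BitLt o) u v
LexLeq⇒Lex< o (inj₁ u≡v) u≢v = ⊥-elim (u≢v u≡v)
LexLeq⇒Lex< o (inj₂ u<v) u≢v = u<v

LexLeq-first-difference : ∀ o {n} {u v : BitString n} {r : Fin n} → LexLeq o u v →
                          (∀ j → j < r → u j ≡ v j) → u r ≢ v r → BitLt o (u r) (v r)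
LexLeq-first-difference o {r = r} u≤v agree uᵣ≢vᵣ
  with LexLeq⇒Lex< o u≤v (λ u≡v → uᵣ≢vᵣ (u≡v r))
... | k , agree′ , uₖ<vₖ with <-cmp k r
... | tri< k<r _ _    = ⊥-elim (≡⇒¬BitLt o (agree k k<r) uₖ<vₖ)
... | tri≈ _ refl _   = uₖ<vₖ
... | tri> _ _ r<k    = ⊥-elim (uᵣ≢vᵣ (agree′ r r<k))

_≐_ : ∀ {m n} → Mat m n → Mat m n → Set
A ≐ B = ∀ i j → A i j ≡ B i j

RowsSorted-resp : ∀ o {m n} {p : Fin m → ℕ} {A B : Mat m n} → B ≐ A → RowsSorted o p A → RowsSorted o p B
RowsSorted-resp o B≐A sorted i i′ same i≤i′ =
  LexLeq-resp o (sym ∘ B≐A i) (sym ∘ B≐A i′) (sorted i i′ same i≤i′)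

ColsSorted-resp : ∀ o {m n} {q : Fin n → ℕ} {A B : Mat m n} → B ≐ A → ColsSorted o q A → ColsSorted o q B
ColsSorted-resp o B≐A sorted j j′ same j≤j′ =
  LexLeq-resp o (λ i → sym (B≐A i j)) (λ i → sym (B≐A i j′)) (sorted j j′ same j≤j′)

first-changed-row : ∀ {m n} (A B : Mat m n) →
                    B ≐ A ⊎ ∃ λ r → (∀ i → i < r → ∀ j → B i j ≡ A i j) × ¬ (∀ j → B r j ≡ A r j)
first-changed-row A B = least-counterexample _ (λ i → all? λ j → B i j ≟ᵇ A i j)

-- Since the rows above the first changed row i are unchanged, the orbit
-- argument finds a row k ≥ i of B, in i's part, that is a copy of the old row i.
rowSort-unchanged-or-descends : ∀ o {m n} {p : Fin m → ℕ} {A B : Mat m n} →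
                                RowSortStep o p A B → B ≐ A ⊎ weight o B ℕ.< weight o A
rowSort-unchanged-or-descends o {m} {p = p} {A} {B} (σ , σ-part , B≡Aσ , sorted)
  with first-changed-row A B
... | inj₁ unchanged = inj₁ unchanged
... | inj₂ (i , agree , changed) =
      inj₂ (weight-mono o i agree (code-mono o (LexLeq⇒Lex< o Bᵢ≤Aᵢ changed)))
  where
  CopyOfRow-i : Fin m → Set
  CopyOfRow-i k = (∀ j → A k j ≡ A i j) × p k ≡ p i

  copies-above : ∀ k → k < i → CopyOfRow-i (σ ⟨$⟩ʳ k) → CopyOfRow-i k
  copies-above k k<i (copy , part) =
    (λ j → trans (sym (agree k k<i j)) (trans (B≡Aσ k j) (copy j))) , trans (sym (σ-part k)) part

  Bᵢ≤Aᵢ : LexLeq o (row B i) (row A i)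
  Bᵢ≤Aᵢ with orbit-escapes σ CopyOfRow-i ((λ _ → refl) , refl) copies-above
  ... | k , i≤k , copy , part =
        LexLeq-resp o (λ _ → refl) (λ j → trans (B≡Aσ k j) (copy j))
                    (sorted i k (trans (sym part) (σ-part k)) i≤k)

-- At the first changed entry (r , c), the orbit argument finds a column k ≥ c
-- (in c's part) of B that is the old column c down to row r; comparing the
-- sorted columns c and k of B at their first difference, row r, gives B r c < A r c.
colSort-unchanged-or-descends : ∀ o {m n} {q : Fin n → ℕ} {A B : Mat m n} →
                                ColSortStep o q A B → B ≐ A ⊎ weight o B ℕ.< weight o A
colSort-unchanged-or-descends o {m} {n} {q} {A} {B} (τ , τ-part , B≡Aτ , sorted)
  with first-changed-row A B
... | inj₁ unchanged = inj₁ unchanged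
... | inj₂ (r , agree , changed)
  with least-counterexample (λ j → B r j ≡ A r j) (λ j → B r j ≟ᵇ A r j)
...   | inj₁ unchanged-r = ⊥-elim (changed unchanged-r)
...   | inj₂ (c , agree-r , changed-rc) =
        inj₂ (weight-mono o r agree (code-mono o (c , agree-r , Brc<Arc)))
  where
  CopyOfCol-c : Fin n → Set
  CopyOfCol-c k = (∀ i → i < r → A i k ≡ A i c) × A r k ≡ A r c × q k ≡ q c

  copies-left : ∀ k → k < c → CopyOfCol-c (τ ⟨$⟩ʳ k) → CopyOfCol-c k
  copies-left k k<c (above , at-r , part) =
    (λ i i<r → trans (sym (agree i i<r k)) (trans (B≡Aτ i k) (above i i<r))) ,
    trans (sym (agree-r k k<c)) (trans (B≡Aτ r k) at-r) ,
    trans (sym (τ-part k)) part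

  Brc<Arc : BitLt o (B r c) (A r c)
  Brc<Arc with orbit-escapes τ CopyOfCol-c ((λ _ _ → refl) , refl , refl) copies-left
  ... | k , c≤k , above , at-r , part =
        subst (BitLt o (B r c)) Brk≡Arc
          (LexLeq-first-difference o (sorted c k (trans (sym part) (τ-part k)) c≤k)
            (λ i i<r → trans (agree i i<r c) (sym (trans (B≡Aτ i k) (above i i<r))))
            (λ Brc≡Brk → changed-rc (trans Brc≡Brk Brk≡Arc)))
    where
    Brk≡Arc : B r k ≡ A r c
    Brk≡Arc = trans (B≡Aτ r k) at-r

Sorted : Bool → {m n : ℕ} → (Fin m → ℕ) → (Fin n → ℕ) → Mat m n → Set
Sorted o p q A = RowsSorted o p A × ColsSorted o q A

sort-round : ∀ o {m n} {p : Fin m → ℕ} {q : Fin n → ℕ} {A B C : Mat m n} →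
             RowsSorted o p A → ColSortStep o q A B → RowSortStep o p B C →
             Sorted o p q B ⊎ Sorted o p q C ⊎ weight o C ℕ.< weight o A
sort-round o rows-A A→B@(_ , _ , _ , cols-B) B→C@(_ , _ , _ , rows-C)
  with colSort-unchanged-or-descends o A→B | rowSort-unchanged-or-descends o B→C
... | inj₁ B≐A | _        = inj₁ (RowsSorted-resp o B≐A rows-A , cols-B)
... | inj₂ _   | inj₁ C≐B = inj₂ (inj₁ (rows-C , ColsSorted-resp o C≐B cols-B))
... | inj₂ B<A | inj₂ C<B = inj₂ (inj₂ (<-trans C<B B<A))

descent : ∀ {G : Set} (w : ℕ → ℕ) → (∀ s → G ⊎ w (suc s) ℕ.< w s) → G
descent {G} w step = go (suc (w 0)) 0 (n<1+n (w 0))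
  where
  go : ∀ bound s → w s ℕ.< bound → G
  go (suc bound) s w<bound with step s
  ... | inj₁ done = done
  ... | inj₂ w′<w = go bound (suc s) (<-≤-trans w′<w (s≤s⁻¹ w<bound))

theorem4 : (o : Bool) (m n : ℕ) (p : Fin m → ℕ) (q : Fin n → ℕ) (A : Mat m n)
           (f : ℕ → Mat m n) → IsRun o p q A f →
           ∃ λ k → RowsSorted o p (f k) × ColsSorted o q (f k)
theorem4 o m n p q A f (_ , rowStep , colStep) = descent w round
  where
  w : ℕ → ℕ
  w s = weight o (f (suc (2 * s)))

  rowStep′ : ∀ s → RowSortStep o p (f (2 + 2 * s)) (f (3 + 2 * s))
  rowStep′ s = subst (λ t → RowSortStep o p (f t) (f (suc t))) (*-suc 2 s) (rowStep (suc s))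

  round : ∀ s → (∃ λ k → Sorted o p q (f k)) ⊎ w (suc s) ℕ.< w s
  round s with sort-round o (proj₂ (proj₂ (proj₂ (rowStep s)))) (colStep s) (rowStep′ s)
  ... | inj₁ sorted-B        = inj₁ (_ , sorted-B)
  ... | inj₂ (inj₁ sorted-C) = inj₁ (_ , sorted-C)
  ... | inj₂ (inj₂ C<A)      = inj₂ (subst (λ t → weight o (f (suc t)) ℕ.< w s) (sym (*-suc 2 s)) C<A)
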